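{- Let $A,B\subseteq\mathbb{Z}$ be finite sets with $|A|=2$ and $|B|\ge 2$. Then $|A\widehat{+}B|=|A|+|B|-3$ if and only if $A=B$.
   Context: For finite sets $A,B\subseteq\mathbb{Z}$, the restricted sumset is $A\widehat{+}B=\{a+b: a\in A,\ b\in B,\ a\neq b\}$. A pair $(A,B)$ with $|A|,|B|\ge 2$ satisfying $|A\widehat{+}B|=|A|+|B|-3$ is called a critical pair; the paper states the theorem as "$(A,B)$ is a critical pair if and only if $A=B$", where throughout the paper all sets considered have at least two elements. -}

module Defs where

open import Data.Integer using (ℤ; _+_)
open import Data.List using (List; length)
open import Data.List.Membership.Propositional using (_∈_)
open import Data.List.Relation.Unary.Unique.Propositional using (Unique)
open import Data.Product using (Σ; ∃; _×_; _,_)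
open import Relation.Binary.PropositionalEquality using (_≡_; _≢_)
open import Function.Bundles using (_⇔_)
open import Data.Nat using (ℕ)

-- A finite subset of ℤ is represented by a duplicate-free list; its
-- cardinality is the length of the list.

_∈RSum[_,_] : ℤ → List ℤ → List ℤ → Set
x ∈RSum[ A , B ] = Σ ℤ λ a → Σ ℤ λ b → a ∈ A × b ∈ B × a ≢ b × x ≡ a + b

RSumCard : List ℤ → List ℤ → ℕ → Set
RSumCard A B n = Σ (List ℤ) λ C → Unique C × (∀ x → (x ∈ C ⇔ x ∈RSum[ A , B ])) × length C ≡ n

SameSet : List ℤ → List ℤ → Set
SameSet A B = ∀ x → (x ∈ A ⇔ x ∈ B)

-- Let A = {p, q} with p < q. Unless B = A, the restricted sumset A +̂ B already
-- has at least |B| elements: send b ↦ a + b for b ≠ a and a ↦ a' + w, where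
-- {a, a'} = A and w ∈ B, w ≠ a' is chosen so that a' + w is not of the form
-- a + b. If max B ≠ q take (a, a', w) = (p, q, max B); if min B ≠ p take
-- (q, p, min B); otherwise B contains p and q, and any further c ∈ B lies
-- strictly between them, so (p, q, c) works. Conversely A +̂ A = {p + q}.
module Submission where

open import Defs
open import Data.Integer using (ℤ)
open import Data.Nat using (ℕ; _+_; _≤_)
open import Data.List using (List; length)
open import Data.List.Relation.Unary.Unique.Propositional using (Unique)
open import Relation.Binary.PropositionalEquality using (_≡_)
open import Function.Bundles using (_⇔_)

open import Level using (Level)
import Data.Integer as ℤ
import Data.Integer.Properties as ℤ
import Data.Nat as ℕ
import Data.Nat.Properties as ℕ
open import Data.List using ([]; _∷_)
open import Data.List.Properties using (length-removeAt′)
open import Data.List.Relation.Unary.Any using (here; there; _─_)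
open import Data.List.Relation.Unary.All as All using (All; []; _∷_; all?)
open import Data.List.Relation.Unary.All.Properties using (¬All⇒Any¬)
open import Data.List.Relation.Unary.AllPairs using (_∷_)
open import Data.List.Membership.Propositional using (_∈_; find)
open import Data.List.Membership.DecPropositional ℤ._≟_ using (_∈?_)
open import Data.List.Membership.Propositional.Properties using (∈-length)
open import Data.List.Relation.Binary.Subset.Propositional using (_⊆_)
open import Data.Product using (_×_; _,_)
open import Data.Sum as Sum using (_⊎_; inj₁; inj₂; [_,_]′)
open import Function using (id; _∘_)
open import Function.Bundles using (mk⇔; Equivalence)
open import Relation.Nullary using (yes; no; contradiction)
open import Relation.Binary using (tri<; tri≈; tri>)
open import Relation.Binary.PropositionalEquality
  using (_≢_; refl; sym; trans; subst; ≢-sym)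
open import Algebra.Properties.AbelianGroup ℤ.+-0-abelianGroup using (∙-cancelˡ)
open import Data.List.Extrema ℤ.≤-totalOrder
  using (max; min; argmax-sel; argmin-sel; ⊥≤max; xs≤max; min≤⊤; min≤xs)

private
  variable
    ℓ₁ ℓ₂ : Level
    X : Set ℓ₁
    Y : Set ℓ₂

∈-─ : ∀ {x y} {ys : List X} (x∈ys : x ∈ ys) → y ∈ ys → y ≢ x → y ∈ (ys ─ x∈ys)
∈-─ (here refl) (here refl) y≢x = contradiction refl y≢x
∈-─ (here refl) (there y∈)  _   = y∈
∈-─ (there _)   (here y≡)   _   = here y≡
∈-─ (there x∈)  (there y∈)  y≢x = there (∈-─ x∈ y∈ y≢x)

injective⇒length-≤ : ∀ {xs : List X} {ys : List Y} (f : X → Y) → Unique xs →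
  (∀ {x y} → x ∈ xs → y ∈ xs → f x ≡ f y → x ≡ y) →
  (∀ {x} → x ∈ xs → f x ∈ ys) → length xs ≤ length ys
injective⇒length-≤ {xs = []} f _ _ _ = ℕ.z≤n
injective⇒length-≤ {xs = x ∷ xs} {ys} f (x∉xs ∷ uxs) inj into =
  subst (ℕ.suc (length xs) ≤_) (sym (length-removeAt′ ys _))
    (ℕ.s≤s (injective⇒length-≤ f uxs (λ x∈ y∈ → inj (there x∈) (there y∈)) into′))
  where
  fx∈ys = into (here refl)
  into′ : ∀ {y} → y ∈ xs → f y ∈ (ys ─ fx∈ys)
  into′ y∈xs = ∈-─ fx∈ys (into (there y∈xs))
    (λ fy≡fx → All.lookup x∉xs y∈xs (inj (here refl) (there y∈xs) (sym fy≡fx)))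

Unique∧⊆⇒length-≤ : ∀ {xs ys : List X} → Unique xs → xs ⊆ ys → length xs ≤ length ys
Unique∧⊆⇒length-≤ uxs xs⊆ys = injective⇒length-≤ id uxs (λ _ _ → id) xs⊆ys

max∈ : ∀ x xs → max x xs ∈ x ∷ xs
max∈ x xs = [ here , there ]′ (argmax-sel id x xs)

min∈ : ∀ x xs → min x xs ∈ x ∷ xs
min∈ x xs = [ here , there ]′ (argmin-sel id x xs)

≤-max : ∀ x xs → All (ℤ._≤ max x xs) (x ∷ xs)
≤-max x xs = ⊥≤max x xs ∷ xs≤max x xs

min-≤ : ∀ x xs → All (min x xs ℤ.≤_) (x ∷ xs)
min-≤ x xs = min≤⊤ x xs ∷ min≤xs x xs

SameSet-pair : ∀ {p q} {B : List ℤ} → p ∈ B → q ∈ B → B ⊆ p ∷ q ∷ [] →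
  SameSet (p ∷ q ∷ []) B
SameSet-pair p∈B q∈B B⊆pq x =
  mk⇔ (λ { (here refl) → p∈B ; (there (here refl)) → q∈B }) B⊆pq

_+̂_⊆_ : List ℤ → List ℤ → List ℤ → Set
A +̂ B ⊆ C = ∀ {x} → x ∈RSum[ A , B ] → x ∈ C

module _ {A C : List ℤ} where

  length-≤-+̂ : ∀ {B a a′ w} → Unique B → A +̂ B ⊆ C →
    a ∈ A → a′ ∈ A → w ∈ B → a′ ≢ w →
    (∀ {b} → b ∈ B → b ≢ a → a′ ℤ.+ w ≢ a ℤ.+ b) → length B ≤ length C
  length-≤-+̂ {B} {a} {a′} {w} uB sums⊆C a∈A a′∈A w∈B a′≢w fresh =
    injective⇒length-≤ f uB f-injective f-into
    where
    f : ℤ → ℤ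
    f b with b ℤ.≟ a
    ... | yes _ = a′ ℤ.+ w
    ... | no  _ = a ℤ.+ b

    f-injective : ∀ {x y} → x ∈ B → y ∈ B → f x ≡ f y → x ≡ y
    f-injective {x} {y} x∈B y∈B fx≡fy with x ℤ.≟ a | y ℤ.≟ a
    ... | yes x≡a | yes y≡a = trans x≡a (sym y≡a)
    ... | yes _   | no  y≢a = contradiction fx≡fy (fresh y∈B y≢a)
    ... | no  x≢a | yes _   = contradiction (sym fx≡fy) (fresh x∈B x≢a)
    ... | no  _   | no  _   = ∙-cancelˡ a x y fx≡fy

    f-into : ∀ {b} → b ∈ B → f b ∈ C
    f-into {b} b∈B with b ℤ.≟ a
    ... | yes _   = sums⊆C (a′ , w , a′∈A , w∈B , a′≢w , refl)
    ... | no  b≢a = sums⊆C (a , b , a∈A , b∈B , ≢-sym b≢a , refl)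

  length-≤-+̂-or-⊆ : ∀ {B p q} → Unique B → A +̂ B ⊆ C → p ℤ.< q → p ∈ A → q ∈ A →
    length B ≤ length C ⊎ (p ∈ B × q ∈ B × B ⊆ A)
  length-≤-+̂-or-⊆ {[]} _ _ _ _ _ = inj₁ ℕ.z≤n
  length-≤-+̂-or-⊆ {x ∷ xs} {p} {q} uB sums⊆C p<q p∈A q∈A
    with max x xs ℤ.≟ q | min x xs ℤ.≟ p
  ... | no M≢q | _ = inj₁ (length-≤-+̂ uB sums⊆C p∈A q∈A (max∈ x xs) (≢-sym M≢q)
          λ b∈ _ → ℤ.<⇒≢ (ℤ.+-mono-<-≤ p<q (All.lookup (≤-max x xs) b∈)) ∘ sym)
  ... | yes _ | no L≢p = inj₁ (length-≤-+̂ uB sums⊆C q∈A p∈A (min∈ x xs) (≢-sym L≢p)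
          λ b∈ _ → ℤ.<⇒≢ (ℤ.+-mono-<-≤ p<q (All.lookup (min-≤ x xs) b∈)))
  ... | yes M≡q | yes L≡p with all? (_∈? A) (x ∷ xs)
  ...   | yes B⊆A = inj₂ (subst (_∈ (x ∷ xs)) L≡p (min∈ x xs) ,
                          subst (_∈ (x ∷ xs)) M≡q (max∈ x xs) , All.lookup B⊆A)
  ...   | no B⊈A with find (¬All⇒Any¬ (_∈? A) (x ∷ xs) B⊈A)
  ...     | c , c∈ , c∉A = inj₁ (length-≤-+̂ uB sums⊆C p∈A q∈A c∈ q≢c q+c-fresh)
    where
    q≢c : q ≢ c
    q≢c refl = c∉A q∈A

    p<c : p ℤ.< c
    p<c = ℤ.≤∧≢⇒< (subst (ℤ._≤ c) L≡p (All.lookup (min-≤ x xs) c∈)) λ { refl → c∉A p∈A }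

    q+c-fresh : ∀ {b} → b ∈ x ∷ xs → b ≢ p → q ℤ.+ c ≢ p ℤ.+ b
    q+c-fresh {b} b∈ _ q+c≡p+b = ℤ.<⇒≢ (begin-strict
      p ℤ.+ b   <⟨ ℤ.+-mono-<-≤ p<c (subst (b ℤ.≤_) M≡q (All.lookup (≤-max x xs) b∈)) ⟩
      c ℤ.+ q   ≡⟨ ℤ.+-comm c q ⟩
      q ℤ.+ c   ∎) (sym q+c≡p+b)
      where open ℤ.≤-Reasoning

length-≤-+̂-or-SameSet : ∀ {p q} {B C : List ℤ} → p ≢ q → Unique B →
  (p ∷ q ∷ []) +̂ B ⊆ C → length B ≤ length C ⊎ SameSet (p ∷ q ∷ []) B
length-≤-+̂-or-SameSet {p} {q} p≢q uB sums⊆C with ℤ.<-cmp p q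
... | tri≈ _ p≡q _ = contradiction p≡q p≢q
... | tri< p<q _ _ = Sum.map₂ (λ (p∈ , q∈ , B⊆A) → SameSet-pair p∈ q∈ B⊆A)
                       (length-≤-+̂-or-⊆ uB sums⊆C p<q (here refl) (there (here refl)))
... | tri> _ _ q<p = Sum.map₂ (λ (q∈ , p∈ , B⊆A) → SameSet-pair p∈ q∈ B⊆A)
                       (length-≤-+̂-or-⊆ uB sums⊆C q<p (there (here refl)) (here refl))

+̂-self : ∀ {p q x} {B : List ℤ} → SameSet (p ∷ q ∷ []) B →
  x ∈RSum[ p ∷ q ∷ [] , B ] → x ≡ p ℤ.+ q
+̂-self {p} {q} A≈B (a , b , a∈ , b∈ , a≢b , refl) with a∈ | Equivalence.from (A≈B b) b∈
... | here refl         | here refl         = contradiction refl a≢b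
... | here refl         | there (here refl) = refl
... | there (here refl) | here refl         = ℤ.+-comm q p
... | there (here refl) | there (here refl) = contradiction refl a≢b

length-+̂-self : ∀ {p q} {B C : List ℤ} → p ≢ q → SameSet (p ∷ q ∷ []) B → Unique C →
  (∀ x → x ∈ C ⇔ x ∈RSum[ p ∷ q ∷ [] , B ]) → length C ≡ 1
length-+̂-self {p} {q} p≢q A≈B uC C≈A+̂B = ℕ.≤-antisym
  (Unique∧⊆⇒length-≤ {ys = p ℤ.+ q ∷ []} uC
    λ {x} x∈C → here (+̂-self A≈B (Equivalence.to (C≈A+̂B x) x∈C)))
  (∈-length (Equivalence.from (C≈A+̂B (p ℤ.+ q))
    (p , q , here refl , Equivalence.to (A≈B q) (there (here refl)) , p≢q , refl)))

theorem1 : (A B : List ℤ) → Unique A → Unique B → length A ≡ 2 → 2 ≤ length B →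
    (n : ℕ) → RSumCard A B n → ((n + 3 ≡ length A + length B) ⇔ SameSet A B)
theorem1 (p ∷ q ∷ []) B ((p≢q ∷ []) ∷ _) uB _ 2≤|B| n (C , uC , C≈A+̂B , refl) =
  mk⇔ critical⇒SameSet SameSet⇒critical
  where
  critical⇒SameSet : length C + 3 ≡ 2 + length B → SameSet (p ∷ q ∷ []) B
  critical⇒SameSet |C|+3≡2+|B| =
    [ (λ |B|≤|C| → contradiction |B|≤|C| (ℕ.<⇒≱ |C|<|B|)) , id ]′
    (length-≤-+̂-or-SameSet p≢q uB λ {x} → Equivalence.from (C≈A+̂B x))
    where
    |C|<|B| : length C ℕ.< length B
    |C|<|B| = ℕ.≤-reflexive
      (ℕ.suc-injective (ℕ.suc-injective (trans (ℕ.+-comm 3 (length C)) |C|+3≡2+|B|)))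

  SameSet⇒critical : SameSet (p ∷ q ∷ []) B → length C + 3 ≡ 2 + length B
  SameSet⇒critical A≈B
    rewrite length-+̂-self p≢q A≈B uC C≈A+̂B
          | ℕ.≤-antisym (Unique∧⊆⇒length-≤ uB λ {x} → Equivalence.from (A≈B x)) 2≤|B| = refl
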